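{- Let $(A,P,B,T,F)$ be a well-formed reversing Petri net. For any forward step $\langle M,H\rangle\xrightarrow{t}\langle M',H'\rangle$ there exists an out-of-causal-order reverse step $\langle M',H'\rangle\rightsquigarrow_o^{t}\langle M,H\rangle$.
   Context: A reversing Petri net (RPN) is a tuple $(A,P,B,T,F)$: $A$ is a finite set of bases (tokens), $\overline{A}=\{\overline a: a\in A\}$ a set of negative tokens; $P$ a finite set of places; $B\subseteq A\times A$ a set of undirected bonds, written $a-b$ for $(a,b)$, with negative bonds $\overline{B}=\{\overline\beta:\beta\in B\}$; $T$ a finite set of transitions; $F:(P\times T)\cup(T\times P)\to 2^{A\cup\overline A\cup B\cup\overline B}$ labels arcs. In each label $\ell=F(x,t)$ or $F(t,x)$ each token $a$ occurs at most once (as $a$ or $\overline a$), $(a,b)\in\ell$ implies $a,b\in\ell$, and labels $F(t,x)$ contain no negative tokens/bonds. Write ${}^\circ t=\{x:F(x,t)\neq\emptyset\}$, $t^\circ=\{x:F(t,x)\neq\emptyset\}$, $\mathrm{pre}(t)=\bigcup_{x}F(x,t)$, $\mathrm{post}(t)=\bigcup_x F(t,x)$, $\mathrm{eff}(t)=\mathrm{post}(t)-\mathrm{pre}(t)$. The RPN is well-formed if for all $t$: $A\cap\mathrm{pre}(t)=A\cap\mathrm{post}(t)$; $a-b\in\mathrm{pre}(t)$ implies $a-b\in\mathrm{post}(t)$; $F(t,x)\cap F(t,y)=\emptyset$ for $x\neq y$. A marking is $M:P\to 2^{A\cup B}$ with $a-b\in M(x)\Rightarrow a,b\in M(x)$;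 a history is $H:T\to 2^{\mathbb N}$; a state is $\langle M,H\rangle$. Standing assumption: there is an initial marking $M_0$ placing each $a\in A$ in exactly one place (initial history $H_0(t)=\emptyset$). For $a\in A$, $C\subseteq A\cup B$: $\mathrm{con}(a,C)=(\{a\}\cap C)\cup\{\beta,b,c:$ there is a sequence $\beta_1,\dots,\beta_n$ with $\beta_i=(a_{i-1},a_i)\in C\cap B$, $a_i\in C\cap A$, $a_0=a$, and $\beta=(b,c)$ is one of the $\beta_i\}$. Forward step: $t$ is forward-enabled in $\langle M,H\rangle$ if (1) for $x\in{}^\circ t$, $a\in F(x,t)\Rightarrow a\in M(x)$ and $\overline a\in F(x,t)\Rightarrow a\notin M(x)$; (2) likewise for bonds $\beta,\overline\beta$; (3) if $a\in F(t,y_1)$, $b\in F(t,y_2)$, $y_1\neq y_2$, then $b\notin\mathrm{con}(a,M(x))$ for all $x\in{}^\circ t$; (4) if $\beta\in F(t,x)$ for some $x\in t^\circ$ and $\beta\in M(y)$ for some $y\in{}^\circ t$ then $\beta\in F(y,t)$. Then $\langle M,H\rangle\xrightarrow{t}\langle M',H'\rangle$ where $M'(x)=M(x)-\bigcup_{a\in F(x,t)}\mathrm{con}(a,M(x))$ if $x\in{}^\circ t$; $M'(x)=M(x)\cup F(t,x)\cup\bigcup_{a\in F(t,x)\cap F(y,t)}\mathrm{con}(a,M(y))$ if $x\in t^\circ$; $M'(x)=M(x)$ otherwise; $H'(t)=H(t)\cup\{\max(\{0\}\cup\bigcup_{t''\in T}H(t''))+1\}$ and $H'(t')=H(t')$ for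 $t'\neq t$. Out-of-causal-order reversal: for a history $H$ and $C\subseteq A\cup B$, $\mathrm{last}_T(C,H)=t$ if $\mathrm{post}(t)\cap C\neq\emptyset$, $H(t)\neq\emptyset$, and there is no $t'\neq t$ with $\mathrm{post}(t')\cap C\neq\emptyset$, $H(t')\neq\emptyset$, $\max H(t')\ge\max H(t)$; otherwise $\mathrm{last}_T(C,H)=\bot$. $\mathrm{last}_P(C,H)=x$ if either $t=\mathrm{last}_T(C,H)\neq\bot$ and $\{x\}=\{y\in t^\circ: F(t,y)\cap C\neq\emptyset\}$, or $\mathrm{last}_T(C,H)=\bot$ and $C\subseteq M_0(x)$; otherwise $\bot$. A transition $t$ is o-enabled in $\langle M,H\rangle$ if $H(t)\neq\emptyset$; then $\langle M,H\rangle\rightsquigarrow_o^{t}\langle M',H'\rangle$ where $H'(t)=H(t)-\{\max H(t)\}$, $H'(t')=H(t')$ for $t'\neq t$, and, writing $C_{b,z}=\mathrm{con}(b,M(z)-\mathrm{eff}(t))$, $M'(x)=\big(M(x)\cup\bigcup_{y\in P,\,a\in M(y)\cap\mathrm{post}(t),\,\mathrm{last}_P(C_{a,y},H')=x}C_{a,y}\big)-\big(\mathrm{eff}(t)\cup\bigcup_{a\in M(x)\cap\mathrm{post}(t),\,\mathrm{last}_P(C_{a,x},H')\neq x}C_{a,x}\big)$.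
   Formalization: The state ⟨M,H⟩ is reachable from ⟨M₀,H₀⟩ by forward and out-of-causal-order reverse steps; for x in both ${}^\circ t$ and $t^\circ$, M'(x) is the first clause's set ∪ F(t,x) ∪ the second clause's union of components. The statement above fails without it. -}

module Defs where

open import Data.Nat using (ℕ; suc; _⊔_; _<_)
open import Data.Fin using (Fin)
open import Data.Bool using (Bool; true; false)
open import Data.List using (List; []; foldr)
open import Data.List.Membership.Propositional using (_∈_)
open import Data.Product using (Σ; _×_; _,_; ∃; ∃-syntax)
open import Data.Sum using (_⊎_)
open import Data.Empty using (⊥)
open import Relation.Nullary using (¬_)
open import Relation.Binary.PropositionalEquality using (_≡_; _≢_)
open import Function.Bundles using (_⇔_)

-- Elements of labels: A ∪ Ā ∪ B ∪ B̄  (bases / negative bases /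
-- bonds / negative bonds).  Bases are Fin nA, bonds are Fin nB.

data Item (nA nB : ℕ) : Set where
  tok  : Fin nA → Item nA nB
  ntok : Fin nA → Item nA nB
  bnd  : Fin nB → Item nA nB
  nbnd : Fin nB → Item nA nB

-- The set of (undirected) bonds
-- B ⊆ A × A is Fin nB, each bond β having its two end points ends β;
-- distinct bonds have distinct (unordered) end-point pairs.
-- Finite subsets of A ∪ Ā ∪ B ∪ B̄ are Bool-valued characteristic functions.

record RPN : Set where
  field
    nA nB nP nT : ℕ
    ends     : Fin nB → Fin nA × Fin nA
    ends-inj : ∀ β β' → (ends β ≡ ends β' ⊎
                 (Σ (Fin nA) λ a → Σ (Fin nA) λ b → ends β ≡ (a , b) × ends β' ≡ (b , a)))
               → β ≡ β'
    Fpt : Fin nP → Fin nT → Item nA nB → Bool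
    Ftp : Fin nT → Fin nP → Item nA nB → Bool
    Fpt-once : ∀ x t a → ¬ (Fpt x t (tok a) ≡ true × Fpt x t (ntok a) ≡ true)
    Ftp-once : ∀ t x a → ¬ (Ftp t x (tok a) ≡ true × Ftp t x (ntok a) ≡ true)
    Fpt-bond : ∀ x t β a b → ends β ≡ (a , b) → Fpt x t (bnd β) ≡ true →
               Fpt x t (tok a) ≡ true × Fpt x t (tok b) ≡ true
    Ftp-bond : ∀ t x β a b → ends β ≡ (a , b) → Ftp t x (bnd β) ≡ true →
               Ftp t x (tok a) ≡ true × Ftp t x (tok b) ≡ true
    Ftp-ntok : ∀ t x a → Ftp t x (ntok a) ≡ false
    Ftp-nbnd : ∀ t x β → Ftp t x (nbnd β) ≡ false
    M₀ : Fin nP → Item nA nB → Bool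

module _ (N : RPN) where
  open RPN N

  It : Set
  It = Item nA nB

  Place Trans Base Bond : Set
  Place = Fin nP
  Trans = Fin nT
  Base  = Fin nA
  Bond  = Fin nB

  Connects : Bond → Base → Base → Set
  Connects β a b = ends β ≡ (a , b) ⊎ ends β ≡ (b , a)

  Marking : Set
  Marking = Place → It → Bool

  History : Set
  History = Trans → List ℕ      -- finite subsets of ℕ

  IsMarking : Marking → Set
  IsMarking M = ∀ x →
      (∀ a → M x (ntok a) ≡ false)
    × (∀ β → M x (nbnd β) ≡ false)
    × (∀ β a b → ends β ≡ (a , b) → M x (bnd β) ≡ true →
         M x (tok a) ≡ true × M x (tok b) ≡ true)

  InitialOK : Set
  InitialOK = IsMarking M₀ ×
    (∀ a → Σ Place λ x → M₀ x (tok a) ≡ true × (∀ y → M₀ y (tok a) ≡ true → y ≡ x))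

  pre post eff : Trans → It → Set
  pre  t i = Σ Place λ x → Fpt x t i ≡ true
  post t i = Σ Place λ x → Ftp t x i ≡ true
  eff  t i = post t i × ¬ pre t i

  InPre InPost : Place → Trans → Set
  InPre  x t = Σ It λ i → Fpt x t i ≡ true
  InPost x t = Σ It λ i → Ftp t x i ≡ true

  WellFormed : Set
  WellFormed = ∀ t →
      (∀ a → pre t (tok a) ⇔ post t (tok a))
    × (∀ β → pre t (bnd β) → post t (bnd β))
    × (∀ x y i → x ≢ y → Ftp t x i ≡ true → Ftp t y i ≡ true → ⊥)

  data Path (C : It → Set) (a : Base) : Base → Set where
    here : Path C a a
    step : ∀ {b c} β → Path C a b → Connects β b c → C (bnd β) → C (tok c) →
           Path C a c

  con : Base → (It → Set) → It → Set
  con a C i =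
      (i ≡ tok a × C (tok a))
    ⊎ (Σ Base λ b → Σ Base λ c → Σ Bond λ β →
         Path C a b × Connects β b c × C (bnd β) × C (tok c) ×
         (i ≡ bnd β ⊎ i ≡ tok b ⊎ i ≡ tok c))

  ⟦_⟧ : (It → Bool) → It → Set
  ⟦ S ⟧ i = S i ≡ true

  State : Set
  State = Marking × History

  maxList : List ℕ → ℕ
  maxList = foldr _⊔_ 0

  maxAll : History → ℕ
  maxAll H = maxList (Data.List.concat (Data.List.map H (Data.List.allFin nT)))
    where import Data.List

  FEnabled : State → Trans → Set
  FEnabled (M , H) t =
      (∀ x a → Fpt x t (tok a) ≡ true → M x (tok a) ≡ true)
    × (∀ x a → Fpt x t (ntok a) ≡ true → M x (tok a) ≡ false)
    × (∀ x β → Fpt x t (bnd β) ≡ true → M x (bnd β) ≡ true)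
    × (∀ x β → Fpt x t (nbnd β) ≡ true → M x (bnd β) ≡ false)
    × (∀ a b y₁ y₂ → Ftp t y₁ (tok a) ≡ true → Ftp t y₂ (tok b) ≡ true → y₁ ≢ y₂ →
         ∀ x → InPre x t → ¬ con a ⟦ M x ⟧ (tok b))
    × (∀ β x y → Ftp t x (bnd β) ≡ true → InPre y t → M y (bnd β) ≡ true →
         Fpt y t (bnd β) ≡ true)

  FStep : State → Trans → State → Set
  FStep (M , H) t (M' , H') =
      FEnabled (M , H) t
    × (∀ x i → ⟦ M' x ⟧ i ⇔
         ( (⟦ M x ⟧ i × ¬ (Σ Base λ a → Fpt x t (tok a) ≡ true × con a ⟦ M x ⟧ i))
         ⊎ ⟦ Ftp t x ⟧ i
         ⊎ (Σ Base λ a → Σ Place λ y →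
              Ftp t x (tok a) ≡ true × Fpt y t (tok a) ≡ true × con a ⟦ M y ⟧ i)))
    × (∀ n → n ∈ H' t ⇔ (n ∈ H t ⊎ n ≡ suc (maxAll H)))
    × (∀ t' → t' ≢ t → ∀ n → n ∈ H' t' ⇔ n ∈ H t')

  Nonempty : List ℕ → Set
  Nonempty S = Σ ℕ λ n → n ∈ S

  LastT : (It → Set) → History → Trans → Set
  LastT C H t =
      (Σ It λ i → post t i × C i)
    × Nonempty (H t)
    × (∀ t' → t' ≢ t → (Σ It λ i → post t' i × C i) → Nonempty (H t') →
         maxList (H t') < maxList (H t))

  LastP : (It → Set) → History → Place → Set
  LastP C H x =
      (Σ Trans λ t → LastT C H t ×
         (∀ y → (Σ It λ i → Ftp t y i ≡ true × C i) ⇔ y ≡ x))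
    ⊎ (¬ (Σ Trans λ t → LastT C H t) × (∀ i → C i → M₀ x i ≡ true))

  OStep : State → Trans → State → Set
  OStep (M , H) t (M' , H') =
      Nonempty (H t)
    × (∀ n → n ∈ H' t ⇔ (n ∈ H t × n ≢ maxList (H t)))
    × (∀ t' → t' ≢ t → ∀ n → n ∈ H' t' ⇔ n ∈ H t')
    × (∀ x i → ⟦ M' x ⟧ i ⇔
         ( (⟦ M x ⟧ i ⊎ (Σ Place λ y → Σ Base λ a →
               M y (tok a) ≡ true × post t (tok a) × LastP (Cc y a) H' x × Cc y a i))
         × ¬ (eff t i ⊎ (Σ Base λ a →
               M x (tok a) ≡ true × post t (tok a) × ¬ LastP (Cc x a) H' x × Cc x a i))))
    where
      Cc : Place → Base → It → Set
      Cc z a = con a (λ j → M z j ≡ true × ¬ eff t j)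

  data Reachable : State → Set where
    init : Reachable (M₀ , λ _ → [])
    fwd  : ∀ {S S'} t → Reachable S → FStep S t S' → Reachable S'
    rev  : ∀ {S S'} t → Reachable S → OStep S t S' → Reachable S'

-- The argument runs through an invariant of reachable states ⟨M,H⟩:
-- markings are well formed, every base lies in at most one place, and for a base c
-- in place z the connected component con(c, M(z)) has last_P equal to z under H.
-- For a forward step ⟨M,H⟩ —t→ ⟨M',H'⟩ the history obtained by undoing the last
-- firing of t is H again.  A component moved by t from w ∈ °t to y ∈ t° is, once the
-- bonds created by t are discarded, exactly its old component in M(w), so by the
-- invariant its last_P is w: reversal sends it back.  Components untouched by t keep
-- their place, and discarding eff(t) removes precisely what t created, giving M.
-- Preservation of the invariant by both kinds of steps uses that last_P of a set
-- disjoint from post(t) does not see the history of t.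

module Submission where

open import Defs
open import Data.Nat using (ℕ; zero; suc; _+_; _≤_; _<_; _≤′_; ≤′-refl; ≤′-step; z≤n; s≤s)
import Data.Nat.Properties as ℕₚ
open import Data.Fin using (Fin)
import Data.Fin as Fin
import Data.Fin.Properties as Finₚ
open import Data.Bool using (true)
import Data.Bool.Properties as Boolₚ
open import Data.List using (List; []; _∷_)
open import Data.List.Membership.Propositional using (_∈_)
open import Data.List.Relation.Unary.Any using (here; there)
import Data.List.Membership.Propositional.Properties as ∈ₚ
open import Data.Product using (Σ; _×_; _,_; proj₁; proj₂)
import Data.Product.Properties as ×ₚ
open import Data.Sum using (_⊎_; inj₁; inj₂)
open import Data.Empty using (⊥-elim)
open import Relation.Nullary using (¬_; Dec; yes; no)
open import Relation.Nullary.Decidable using (_×-dec_; _⊎-dec_; _→-dec_; ¬?; map′; decidable-stable)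
open import Relation.Binary.PropositionalEquality using (_≡_; _≢_; refl; sym; trans; cong; subst; subst₂)
open import Function.Bundles using (_⇔_; mk⇔; Equivalence)

open Equivalence using (to; from)

module Components (N : RPN) where
  open RPN N

  Pred : Set₁
  Pred = It N → Set

  infix 4 _⊆_ _≐_

  _⊆_ : Pred → Pred → Set
  C ⊆ D = ∀ i → C i → D i

  _≐_ : Pred → Pred → Set
  C ≐ D = C ⊆ D × D ⊆ C

  ≐-sym : ∀ {C D} → C ≐ D → D ≐ C
  ≐-sym (f , g) = g , f

  BondClosed : Pred → Set
  BondClosed C = ∀ β a b → ends β ≡ (a , b) → C (bnd β) → C (tok a) × C (tok b)

  connects-sym : ∀ {β b c} → Connects N β b c → Connects N β c b
  connects-sym (inj₁ e) = inj₂ e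
  connects-sym (inj₂ e) = inj₁ e

  connects-ends : ∀ {C β b c} → BondClosed C → Connects N β b c → C (bnd β) → C (tok b) × C (tok c)
  connects-ends cl (inj₁ e) cβ = cl _ _ _ e cβ
  connects-ends cl (inj₂ e) cβ = let (cc , cb) = cl _ _ _ e cβ in cb , cc

  Ftp-connects : ∀ {t y β b c} → Connects N β b c → Ftp t y (bnd β) ≡ true → Ftp t y (tok b) ≡ true
  Ftp-connects (inj₁ e) f = proj₁ (Ftp-bond _ _ _ _ _ e f)
  Ftp-connects (inj₂ e) f = proj₂ (Ftp-bond _ _ _ _ _ e f)

  path-target : ∀ {C a b} → Path N C a b → C (tok a) → C (tok b)
  path-target here ca = ca
  path-target (step _ _ _ _ cc) _ = cc

  path-prepend : ∀ {C β a₀ a b} → Connects N β a₀ a → C (bnd β) → C (tok a) →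
                 Path N C a b → Path N C a₀ b
  path-prepend cn cβ ca here = step _ here cn cβ ca
  path-prepend cn cβ ca (step β p cn' cβ' cc) = step β (path-prepend cn cβ ca p) cn' cβ' cc

  path-reverse : ∀ {C a b} → Path N C a b → C (tok a) → Path N C b a
  path-reverse here ca = here
  path-reverse (step β p cn cβ cc) ca =
    path-prepend (connects-sym cn) cβ (path-target p ca) (path-reverse p ca)

  con⇒path : ∀ {C a d} → con N a C (tok d) → Path N C a d
  con⇒path (inj₁ (refl , _)) = here
  con⇒path (inj₂ (_ , _ , _ , p , _ , _ , _ , inj₂ (inj₁ refl))) = p
  con⇒path (inj₂ (_ , _ , β , p , cn , cβ , cc , inj₂ (inj₂ refl))) = step β p cn cβ cc

  path⇒con : ∀ {C a d} → Path N C a d → C (tok d) → con N a C (tok d)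
  path⇒con here cd = inj₁ (refl , cd)
  path⇒con (step β p cn cβ cc) _ = inj₂ (_ , _ , β , p , cn , cβ , cc , inj₂ (inj₂ refl))

  con-self : ∀ {C a} → C (tok a) → con N a C (tok a)
  con-self ca = inj₁ (refl , ca)

  con-no-ntok : ∀ {C a d} → ¬ con N a C (ntok d)
  con-no-ntok (inj₁ (() , _))
  con-no-ntok (inj₂ (_ , _ , _ , _ , _ , _ , _ , inj₁ ()))
  con-no-ntok (inj₂ (_ , _ , _ , _ , _ , _ , _ , inj₂ (inj₁ ())))
  con-no-ntok (inj₂ (_ , _ , _ , _ , _ , _ , _ , inj₂ (inj₂ ())))

  con-no-nbnd : ∀ {C a d} → ¬ con N a C (nbnd d)
  con-no-nbnd (inj₁ (() , _))
  con-no-nbnd (inj₂ (_ , _ , _ , _ , _ , _ , _ , inj₁ ()))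
  con-no-nbnd (inj₂ (_ , _ , _ , _ , _ , _ , _ , inj₂ (inj₁ ())))
  con-no-nbnd (inj₂ (_ , _ , _ , _ , _ , _ , _ , inj₂ (inj₂ ())))

  con-extend : ∀ {C a β b c} → con N a C (tok b) → Connects N β b c → C (bnd β) → C (tok c) →
               con N a C (bnd β) × con N a C (tok c)
  con-extend cb cn cβ cc = let p = con⇒path cb in
    inj₂ (_ , _ , _ , p , cn , cβ , cc , inj₁ refl) , inj₂ (_ , _ , _ , p , cn , cβ , cc , inj₂ (inj₂ refl))

  con-⊆ : ∀ {C a} → BondClosed C → con N a C ⊆ C
  con-⊆ cl _ (inj₁ (refl , ca)) = ca
  con-⊆ cl _ (inj₂ (_ , _ , _ , _ , _ , cβ , _ , inj₁ refl)) = cβ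
  con-⊆ {C} cl _ (inj₂ (_ , _ , _ , _ , cn , cβ , _ , inj₂ (inj₁ refl))) = proj₁ (connects-ends {C} cl cn cβ)
  con-⊆ cl _ (inj₂ (_ , _ , _ , _ , _ , _ , cc , inj₂ (inj₂ refl))) = cc

  con-source : ∀ {C a j} → BondClosed C → con N a C j → C (tok a)
  con-source cl (inj₁ (_ , ca)) = ca
  con-source {C} cl (inj₂ (_ , _ , _ , p , cn , cβ , _ , _)) = first p cn cβ
    where
    first : ∀ {a b c β} → Path N C a b → Connects N β b c → C (bnd β) → C (tok a)
    first here cn cβ = proj₁ (connects-ends {C} cl cn cβ)
    first (step _ p cn' cβ' _) _ _ = first p cn' cβ'

  con-bond-ends : ∀ {C a β x y} → ends β ≡ (x , y) → con N a C (bnd β) →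
                  con N a C (tok x) × con N a C (tok y)
  con-bond-ends {C} {a} {β} e (inj₂ (b , c , _ , p , cn , cβ , cc , inj₁ refl)) = orient cn e
    where
    cb : con N a C (tok b)
    cb = inj₂ (b , c , β , p , cn , cβ , cc , inj₂ (inj₁ refl))
    cc' : con N a C (tok c)
    cc' = inj₂ (b , c , β , p , cn , cβ , cc , inj₂ (inj₂ refl))
    orient : ∀ {x y} → Connects N β b c → ends β ≡ (x , y) → con N a C (tok x) × con N a C (tok y)
    orient (inj₁ e₁) e₂ with trans (sym e₁) e₂
    ... | refl = cb , cc'
    orient (inj₂ e₁) e₂ with trans (sym e₁) e₂
    ... | refl = cc' , cb
  con-bond-ends _ (inj₂ (_ , _ , _ , _ , _ , _ , _ , inj₂ (inj₁ ())))
  con-bond-ends _ (inj₂ (_ , _ , _ , _ , _ , _ , _ , inj₂ (inj₂ ())))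

  con-connects-left : ∀ {C a β b c} → Connects N β b c → con N a C (bnd β) → con N a C (tok b)
  con-connects-left (inj₁ e) k = proj₁ (con-bond-ends e k)
  con-connects-left (inj₂ e) k = proj₂ (con-bond-ends e k)

  con-connects-right : ∀ {C a β b c} → Connects N β b c → con N a C (bnd β) → con N a C (tok c)
  con-connects-right (inj₁ e) k = proj₂ (con-bond-ends e k)
  con-connects-right (inj₂ e) k = proj₁ (con-bond-ends e k)

  con-minimal : ∀ {C a} (K : Pred) → K (tok a) →
    (∀ β b c → Connects N β b c → C (bnd β) → C (tok c) → K (tok b) → K (bnd β) × K (tok c)) →
    con N a C ⊆ K
  con-minimal {C} {a} K ka cl = go
    where
    along : ∀ {b} → Path N C a b → K (tok b)
    along here = ka
    along (step β p cn cβ cc) = proj₂ (cl _ _ _ cn cβ cc (along p))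
    go : con N a C ⊆ K
    go _ (inj₁ (refl , _)) = ka
    go _ (inj₂ (_ , _ , _ , p , cn , cβ , cc , inj₁ refl)) = proj₁ (cl _ _ _ cn cβ cc (along p))
    go _ (inj₂ (_ , _ , _ , p , _ , _ , _ , inj₂ (inj₁ refl))) = along p
    go _ (inj₂ (_ , _ , _ , p , cn , cβ , cc , inj₂ (inj₂ refl))) = proj₂ (cl _ _ _ cn cβ cc (along p))

  con-mono : ∀ {C D a} → con N a C ⊆ D → con N a C ⊆ con N a D
  con-mono {C} {D} {a} h = go
    where
    bond : ∀ {b c β} → Path N C a b → Connects N β b c → C (bnd β) → C (tok c) → D (bnd β)
    bond p cn cβ cc = h _ (inj₂ (_ , _ , _ , p , cn , cβ , cc , inj₁ refl))
    end : ∀ {b c β} → Path N C a b → Connects N β b c → C (bnd β) → C (tok c) → D (tok c)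
    end p cn cβ cc = h _ (inj₂ (_ , _ , _ , p , cn , cβ , cc , inj₂ (inj₂ refl)))
    along : ∀ {b} → Path N C a b → Path N D a b
    along here = here
    along (step β p cn cβ cc) = step β (along p) cn (bond p cn cβ cc) (end p cn cβ cc)
    go : con N a C ⊆ con N a D
    go _ (inj₁ (e , ca)) = inj₁ (e , h _ (inj₁ (refl , ca)))
    go _ (inj₂ (b , c , β , p , cn , cβ , cc , w)) =
      inj₂ (b , c , β , along p , cn , bond p cn cβ cc , end p cn cβ cc , w)

  con-trans : ∀ {C a b} → con N a C (tok b) → con N b C ⊆ con N a C
  con-trans {C} {a} cb = con-minimal (con N a C) cb λ _ _ _ cn cβ cc ka → con-extend ka cn cβ cc

  con-sym : ∀ {C a b} → con N a C (tok b) → C (tok a) → con N b C (tok a)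
  con-sym cb ca = path⇒con (path-reverse (con⇒path cb) ca) ca

  con-same : ∀ {C a b} → con N a C (tok b) → C (tok a) → con N b C ≐ con N a C
  con-same cb ca = con-trans cb , con-trans (con-sym cb ca)

  con-meet : ∀ {C a c} j → C (tok c) → con N a C j → con N c C j → con N a C (tok c)
  con-meet (tok d) cc ka kc = con-trans ka _ (con-sym kc cc)
  con-meet (bnd β) cc ka kc with ends β in e
  ... | (x , _) = con-meet (tok x) cc (proj₁ (con-bond-ends e ka)) (proj₁ (con-bond-ends e kc))
  con-meet (ntok _) _ ka _ = ⊥-elim (con-no-ntok ka)
  con-meet (nbnd _) _ ka _ = ⊥-elim (con-no-nbnd ka)

  con-meet-same : ∀ {C a c} j → C (tok a) → C (tok c) → con N a C j → con N c C j → con N a C ≐ con N c C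
  con-meet-same j ca cc ka kc = ≐-sym (con-same (con-meet j cc ka kc) ca)

-- Recovering last_P from its double negation (reverse steps are specified through
-- ¬ last_P) needs con to be decidable; reachability stabilises after nA rounds.
module Decision (N : RPN) where
  open RPN N
  open Components N

  DecidablePred : Pred → Set
  DecidablePred C = ∀ i → Dec (C i)

  _≟-item_ : (i j : It N) → Dec (i ≡ j)
  tok a  ≟-item tok b  = map′ (cong tok) (λ { refl → refl }) (a Finₚ.≟ b)
  ntok a ≟-item ntok b = map′ (cong ntok) (λ { refl → refl }) (a Finₚ.≟ b)
  bnd β  ≟-item bnd γ  = map′ (cong bnd) (λ { refl → refl }) (β Finₚ.≟ γ)
  nbnd β ≟-item nbnd γ = map′ (cong nbnd) (λ { refl → refl }) (β Finₚ.≟ γ)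
  tok _  ≟-item ntok _ = no λ ()
  tok _  ≟-item bnd _  = no λ ()
  tok _  ≟-item nbnd _ = no λ ()
  ntok _ ≟-item tok _  = no λ ()
  ntok _ ≟-item bnd _  = no λ ()
  ntok _ ≟-item nbnd _ = no λ ()
  bnd _  ≟-item tok _  = no λ ()
  bnd _  ≟-item ntok _ = no λ ()
  bnd _  ≟-item nbnd _ = no λ ()
  nbnd _ ≟-item tok _  = no λ ()
  nbnd _ ≟-item ntok _ = no λ ()
  nbnd _ ≟-item bnd _  = no λ ()

  connects? : ∀ β b c → Dec (Connects N β b c)
  connects? β b c = ends β ≟-ends (b , c) ⊎-dec ends β ≟-ends (c , b)
    where
    _≟-ends_ : (p q : Fin nA × Fin nA) → Dec (p ≡ q)
    _≟-ends_ = ×ₚ.≡-dec Finₚ._≟_ Finₚ._≟_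

  count : ∀ {n} (P : Fin n → Set) → (∀ i → Dec (P i)) → ℕ
  count {zero} P P? = 0
  count {suc n} P P? = indicator (P? Fin.zero) + count (λ i → P (Fin.suc i)) (λ i → P? (Fin.suc i))
    where
    indicator : ∀ {A : Set} → Dec A → ℕ
    indicator (yes _) = 1
    indicator (no _) = 0

  count≤n : ∀ {n} (P : Fin n → Set) P? → count P P? ≤ n
  count≤n {zero} P P? = z≤n
  count≤n {suc n} P P? with P? Fin.zero
  ... | yes _ = s≤s (count≤n _ _)
  ... | no _ = ℕₚ.m≤n⇒m≤1+n (count≤n _ _)

  count-mono : ∀ {n} (P Q : Fin n → Set) P? Q? → (∀ i → P i → Q i) → count P P? ≤ count Q Q?
  count-mono {zero} P Q P? Q? h = z≤n
  count-mono {suc n} P Q P? Q? h with P? Fin.zero | Q? Fin.zero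
  ... | yes _ | yes _ = s≤s (count-mono _ _ _ _ (λ i → h (Fin.suc i)))
  ... | yes p | no ¬q = ⊥-elim (¬q (h _ p))
  ... | no _  | yes _ = ℕₚ.m≤n⇒m≤1+n (count-mono _ _ _ _ (λ i → h (Fin.suc i)))
  ... | no _  | no _  = count-mono _ _ _ _ (λ i → h (Fin.suc i))

  count-strict : ∀ {n} (P Q : Fin n → Set) P? Q? → (∀ i → P i → Q i) →
                 ∀ j → ¬ P j → Q j → count P P? < count Q Q?
  count-strict {suc n} P Q P? Q? h Fin.zero ¬p q with P? Fin.zero | Q? Fin.zero
  ... | yes p | _     = ⊥-elim (¬p p)
  ... | no _  | no ¬q = ⊥-elim (¬q q)
  ... | no _  | yes _ = s≤s (count-mono _ _ _ _ (λ i → h (Fin.suc i)))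
  count-strict {suc n} P Q P? Q? h (Fin.suc j) ¬p q with P? Fin.zero | Q? Fin.zero
  ... | yes _ | yes _ = s≤s (count-strict _ _ _ _ (λ i → h (Fin.suc i)) j ¬p q)
  ... | yes p | no ¬q = ⊥-elim (¬q (h _ p))
  ... | no _  | yes _ = ℕₚ.m≤n⇒m≤1+n (count-strict _ _ _ _ (λ i → h (Fin.suc i)) j ¬p q)
  ... | no _  | no _  = count-strict _ _ _ _ (λ i → h (Fin.suc i)) j ¬p q

  count-pos : ∀ {n} (P : Fin n → Set) P? → ∀ j → P j → 1 ≤ count P P?
  count-pos {suc n} P P? Fin.zero p with P? Fin.zero
  ... | yes _ = s≤s z≤n
  ... | no ¬p = ⊥-elim (¬p p)
  count-pos {suc n} P P? (Fin.suc j) p with P? Fin.zero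
  ... | yes _ = s≤s z≤n
  ... | no _  = count-pos _ _ j p

  module Reachability (C : Pred) (C? : DecidablePred C) (a : Fin nA) where
    Within : ℕ → Fin nA → Set
    Within zero b = b ≡ a
    Within (suc k) b = Within k b ⊎
      Σ (Fin nB) λ β → Σ (Fin nA) λ b' → Within k b' × Connects N β b' b × C (bnd β) × C (tok b)

    within? : ∀ k b → Dec (Within k b)
    within? zero b = b Finₚ.≟ a
    within? (suc k) b = within? k b ⊎-dec Finₚ.any? λ β → Finₚ.any? λ b' →
      within? k b' ×-dec (connects? β b' b ×-dec (C? (bnd β) ×-dec C? (tok b)))

    Stable : ℕ → Set
    Stable k = ∀ b → Within (suc k) b → Within k b

    within-mono : ∀ {k m} → k ≤′ m → ∀ {b} → Within k b → Within m b
    within-mono ≤′-refl r = r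
    within-mono (≤′-step k≤m) r = inj₁ (within-mono k≤m r)

    stable-mono : ∀ {j k} → j ≤′ k → Stable j → Stable k
    stable-mono ≤′-refl s = s
    stable-mono (≤′-step j≤k) s b (inj₁ r) = r
    stable-mono (≤′-step j≤k) s b (inj₂ (β , b' , r , rest)) = inj₂ (β , b' , stable-mono j≤k s b' r , rest)

    stable-within : ∀ {j k} → j ≤′ k → Stable j → ∀ {b} → Within k b → Within j b
    stable-within ≤′-refl s r = r
    stable-within (≤′-step j≤k) s {b} r = stable-within j≤k s (stable-mono j≤k s b r)

    -- until Within stabilises, each round adds a new base
    stabilises : ∀ k → (Σ ℕ λ j → j ≤ k × Stable j) ⊎ suc k ≤ count (Within k) (within? k)
    stabilises zero = inj₂ (count-pos (Within 0) (within? 0) a refl)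
    stabilises (suc k) with stabilises k
    ... | inj₁ (j , j≤k , s) = inj₁ (j , ℕₚ.m≤n⇒m≤1+n j≤k , s)
    ... | inj₂ grows with Finₚ.all? (λ b → within? (suc k) b →-dec within? k b)
    ... | yes s = inj₁ (k , ℕₚ.n≤1+n k , s)
    ... | no ¬s with Finₚ.¬∀⟶∃¬ nA _ (λ b → within? (suc k) b →-dec within? k b) ¬s
    ... | (b , ¬imp) = inj₂ (ℕₚ.≤-trans (s≤s grows)
          (count-strict (Within k) (Within (suc k)) (within? k) (within? (suc k)) (λ _ → inj₁)
            b (λ r → ¬imp (λ _ → r))
            (decidable-stable (within? (suc k) b) λ ¬r → ¬imp (λ r → ⊥-elim (¬r r)))))

    stable-by-nA : Σ ℕ λ j → j ≤ nA × Stable j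
    stable-by-nA with stabilises nA
    ... | inj₁ s = s
    ... | inj₂ big = ⊥-elim (ℕₚ.<-irrefl refl (ℕₚ.≤-trans big (count≤n (Within nA) (within? nA))))

    within-nA : ∀ k {b} → Within k b → Within nA b
    within-nA k r with stable-by-nA
    ... | (j , j≤nA , s) with ℕₚ.≤-total k j
    ... | inj₁ k≤j = within-mono (ℕₚ.≤⇒≤′ j≤nA) (within-mono (ℕₚ.≤⇒≤′ k≤j) r)
    ... | inj₂ j≤k = within-mono (ℕₚ.≤⇒≤′ j≤nA) (stable-within (ℕₚ.≤⇒≤′ j≤k) s r)

    path⇒within : ∀ {b} → Path N C a b → Σ ℕ λ k → Within k b
    path⇒within here = 0 , refl
    path⇒within (step β p cn cβ cc) = let (k , r) = path⇒within p in suc k , inj₂ (β , _ , r , cn , cβ , cc)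

    within⇒path : ∀ k {b} → Within k b → Path N C a b
    within⇒path zero refl = here
    within⇒path (suc k) (inj₁ r) = within⇒path k r
    within⇒path (suc k) (inj₂ (β , _ , r , cn , cβ , cc)) = step β (within⇒path k r) cn cβ cc

    path? : ∀ b → Dec (Path N C a b)
    path? b = map′ (within⇒path nA) (λ p → let (k , r) = path⇒within p in within-nA k r) (within? nA b)

  con? : ∀ {C} → DecidablePred C → ∀ a → DecidablePred (con N a C)
  con? {C} C? a i =
    (i ≟-item tok a ×-dec C? (tok a)) ⊎-dec
    Finₚ.any? λ b → Finₚ.any? λ c → Finₚ.any? λ β →
      Reachability.path? C C? a b ×-dec (connects? β b c ×-dec (C? (bnd β) ×-dec (C? (tok c) ×-dec
        (i ≟-item bnd β ⊎-dec (i ≟-item tok b ⊎-dec i ≟-item tok c)))))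

  any-item? : ∀ {P : Pred} → DecidablePred P → Dec (Σ (It N) P)
  any-item? {P} P? = map′ witness split
    (Finₚ.any? (λ a → P? (tok a)) ⊎-dec (Finₚ.any? (λ a → P? (ntok a)) ⊎-dec
     (Finₚ.any? (λ β → P? (bnd β)) ⊎-dec Finₚ.any? (λ β → P? (nbnd β)))))
    where
    witness : _ → Σ (It N) P
    witness (inj₁ (a , p)) = tok a , p
    witness (inj₂ (inj₁ (a , p))) = ntok a , p
    witness (inj₂ (inj₂ (inj₁ (β , p)))) = bnd β , p
    witness (inj₂ (inj₂ (inj₂ (β , p)))) = nbnd β , p
    split : Σ (It N) P → _
    split (tok a , p) = inj₁ (a , p)
    split (ntok a , p) = inj₂ (inj₁ (a , p))
    split (bnd β , p) = inj₂ (inj₂ (inj₁ (β , p)))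
    split (nbnd β , p) = inj₂ (inj₂ (inj₂ (β , p)))

  all-item? : ∀ {P : Pred} → DecidablePred P → Dec (∀ i → P i)
  all-item? {P} P? with any-item? (λ i → ¬? (P? i))
  ... | yes (i , ¬p) = no λ h → ¬p (h i)
  ... | no ¬∃ = yes λ i → decidable-stable (P? i) λ ¬p → ¬∃ (i , ¬p)

  _⇔-dec_ : ∀ {A B : Set} → Dec A → Dec B → Dec (A ⇔ B)
  a? ⇔-dec b? = map′ (λ (f , g) → mk⇔ f g) (λ e → to e , from e) ((a? →-dec b?) ×-dec (b? →-dec a?))

  post? : ∀ t i → Dec (post N t i)
  post? t i = Finₚ.any? λ x → Ftp t x i Boolₚ.≟ true

  pre? : ∀ t i → Dec (pre N t i)
  pre? t i = Finₚ.any? λ x → Fpt x t i Boolₚ.≟ true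

  eff? : ∀ t i → Dec (eff N t i)
  eff? t i = post? t i ×-dec ¬? (pre? t i)

  nonempty? : (xs : List ℕ) → Dec (Nonempty N xs)
  nonempty? [] = no λ { (_ , ()) }
  nonempty? (x ∷ _) = yes (x , here refl)

  lastT? : ∀ {C} → DecidablePred C → ∀ H t → Dec (LastT N C H t)
  lastT? C? H t = any-item? (λ i → post? t i ×-dec C? i) ×-dec (nonempty? (H t) ×-dec
    Finₚ.all? λ t' → ¬? (t' Finₚ.≟ t) →-dec (any-item? (λ i → post? t' i ×-dec C? i) →-dec
      (nonempty? (H t') →-dec (maxList N (H t') ℕₚ.<? maxList N (H t)))))

  lastP? : ∀ {C} → DecidablePred C → ∀ H x → Dec (LastP N C H x)
  lastP? C? H x =
    Finₚ.any? (λ t → lastT? C? H t ×-dec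
      Finₚ.all? λ y → any-item? (λ i → (Ftp t y i Boolₚ.≟ true) ×-dec C? i) ⇔-dec (y Finₚ.≟ x))
    ⊎-dec (¬? (Finₚ.any? (lastT? C? H)) ×-dec all-item? (λ i → C? i →-dec (M₀ x i Boolₚ.≟ true)))

module Histories (N : RPN) where
  open RPN N

  maxList-upper : ∀ {n xs} → n ∈ xs → n ≤ maxList N xs
  maxList-upper {xs = x ∷ xs} (here refl) = ℕₚ.m≤m⊔n x (maxList N xs)
  maxList-upper {xs = x ∷ xs} (there p) = ℕₚ.≤-trans (maxList-upper p) (ℕₚ.m≤n⊔m x (maxList N xs))

  maxList-∈-∷ : ∀ x xs → maxList N (x ∷ xs) ∈ x ∷ xs
  maxList-∈-∷ x [] = here (ℕₚ.⊔-identityʳ x)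
  maxList-∈-∷ x (y ∷ xs) with ℕₚ.⊔-sel x (maxList N (y ∷ xs))
  ... | inj₁ e = here e
  ... | inj₂ e = there (subst (_∈ y ∷ xs) (sym e) (maxList-∈-∷ y xs))

  maxList-∈ : ∀ {n xs} → n ∈ xs → maxList N xs ∈ xs
  maxList-∈ {xs = x ∷ xs} _ = maxList-∈-∷ x xs

  maxList-cong : ∀ {xs ys} → (∀ n → n ∈ xs ⇔ n ∈ ys) → maxList N xs ≡ maxList N ys
  maxList-cong {xs} {ys} e = ℕₚ.≤-antisym (bound xs ys (λ n → to (e n))) (bound ys xs (λ n → from (e n)))
    where
    bound : ∀ xs ys → (∀ n → n ∈ xs → n ∈ ys) → maxList N xs ≤ maxList N ys
    bound [] ys h = z≤n
    bound (x ∷ xs) ys h = maxList-upper (h _ (maxList-∈-∷ x xs))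

  maxAll-upper : ∀ (H : History N) t {n} → n ∈ H t → n ≤ maxAll N H
  maxAll-upper H t n∈ = maxList-upper (∈ₚ.∈-concat⁺′ n∈ (∈ₚ.∈-map⁺ H (∈ₚ.∈-allFin t)))

  SameExcept : Trans N → History N → History N → Set
  SameExcept t H H' = ∀ t' → t' ≢ t → ∀ n → n ∈ H' t' ⇔ n ∈ H t'

  sameExcept-sym : ∀ {t H H'} → SameExcept t H H' → SameExcept t H' H
  sameExcept-sym same t' t'≢t n = mk⇔ (from (same t' t'≢t n)) (to (same t' t'≢t n))

module LastPlace (N : RPN) (initialOK : InitialOK N) where
  open RPN N
  open Components N
  open Decision N
  open Histories N

  lastT-unique : ∀ {C H t₁ t₂} → LastT N C H t₁ → LastT N C H t₂ → t₁ ≡ t₂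
  lastT-unique {t₁ = t₁} {t₂} (w₁ , n₁ , h₁) (w₂ , n₂ , h₂) with t₁ Finₚ.≟ t₂
  ... | yes e = e
  ... | no t₁≢t₂ =
    ⊥-elim (ℕₚ.<-asym (h₁ t₂ (λ e → t₁≢t₂ (sym e)) w₂ n₂) (h₂ t₁ t₁≢t₂ w₁ n₁))

  -- The base is needed in the initial case, where last_P is read off M₀.
  lastP-functional : ∀ {C H x x'} → LastP N C H x → LastP N C H x' → Σ (Fin nA) (λ a → C (tok a)) → x ≡ x'
  lastP-functional (inj₁ (t₁ , lt₁ , at₁)) (inj₁ (t₂ , lt₂ , at₂)) _ with lastT-unique lt₁ lt₂
  ... | refl = let (i , (y , f) , ci) = proj₁ lt₁ in trans (sym (to (at₁ y) (i , f , ci))) (to (at₂ y) (i , f , ci))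
  lastP-functional (inj₁ (t₁ , lt₁ , _)) (inj₂ (¬lt , _)) _ = ⊥-elim (¬lt (t₁ , lt₁))
  lastP-functional (inj₂ (¬lt , _)) (inj₁ (t₂ , lt₂ , _)) _ = ⊥-elim (¬lt (t₂ , lt₂))
  lastP-functional {x = x} {x'} (inj₂ (_ , in₀)) (inj₂ (_ , in₀')) (a , ca) =
    let (_ , _ , only) = proj₂ initialOK a in trans (only x (in₀ _ ca)) (sym (only x' (in₀' _ ca)))

  lastT-resp-≐ : ∀ {C D H t} → C ≐ D → LastT N C H t → LastT N D H t
  lastT-resp-≐ (f , g) ((i , p , ci) , ne , later) =
    (i , p , f i ci) , ne , λ t' t'≢t (j , q , dj) ne' → later t' t'≢t (j , q , g j dj) ne'

  lastP-resp-≐ : ∀ {C D H x} → C ≐ D → LastP N C H x → LastP N D H x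
  lastP-resp-≐ (f , g) (inj₁ (t , lt , at)) = inj₁ (t , lastT-resp-≐ (f , g) lt ,
    λ y → mk⇔ (λ (i , q , di) → to (at y) (i , q , g i di))
              (λ e → let (i , q , ci) = from (at y) e in i , q , f i ci))
  lastP-resp-≐ (f , g) (inj₂ (¬lt , in₀)) =
    inj₂ ((λ (t , lt) → ¬lt (t , lastT-resp-≐ (g , f) lt)) , λ i di → in₀ i (g i di))

  DisjointFromPost : Trans N → Pred → Set
  DisjointFromPost t C = ∀ i → post N t i → ¬ C i

  lastT-unaffected : ∀ {C H H' t t₀} → DisjointFromPost t C → SameExcept t H H' →
                     LastT N C H t₀ → LastT N C H' t₀
  lastT-unaffected {C} {t = t} {t₀} disj same ((i₀ , p₀ , c₀) , (n₀ , n₀∈) , later) =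
    (i₀ , p₀ , c₀) , (n₀ , from (same t₀ t₀≢t n₀) n₀∈) , λ t' t'≢t₀ (i , p , c) (n , n∈) →
      let t'≢t = λ e → disj i (subst (λ z → post N z i) e p) c in
      subst₂ _<_ (maxList-cong (sameExcept-sym same t' t'≢t)) (maxList-cong (sameExcept-sym same t₀ t₀≢t))
        (later t' t'≢t₀ (i , p , c) (n , to (same t' t'≢t n) n∈))
    where
    t₀≢t : t₀ ≢ t
    t₀≢t e = disj i₀ (subst (λ z → post N z i₀) e p₀) c₀

  lastP-unaffected : ∀ {C H H' t x} → DisjointFromPost t C → SameExcept t H H' →
                     LastP N C H x → LastP N C H' x
  lastP-unaffected disj same (inj₁ (t₀ , lt , at)) = inj₁ (t₀ , lastT-unaffected disj same lt , at)
  lastP-unaffected disj same (inj₂ (¬lt , in₀)) =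
    inj₂ ((λ (t₀ , lt) → ¬lt (t₀ , lastT-unaffected disj (sameExcept-sym same) lt)) , in₀)

  lastP-stable : ∀ {C H x} → DecidablePred C → ¬ ¬ LastP N C H x → LastP N C H x
  lastP-stable {H = H} {x} C? = decidable-stable (lastP? C? H x)

module Consistency (N : RPN) (initialOK : InitialOK N) (wellFormed : WellFormed N) where
  open RPN N
  open Components N
  open Decision N
  open Histories N
  open LastPlace N initialOK

  _at_ : Marking N → Place N → Pred
  (M at x) i = M x i ≡ true

  UniqueBases : Marking N → Set
  UniqueBases M = ∀ c y₁ y₂ → M y₁ (tok c) ≡ true → M y₂ (tok c) ≡ true → y₁ ≡ y₂

  ComponentsLocated : Marking N → History N → Set
  ComponentsLocated M H = ∀ z c → M z (tok c) ≡ true → LastP N (con N c (M at z)) H z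

  record Consistent (M : Marking N) (H : History N) : Set where
    field
      marking : IsMarking N M
      unique : UniqueBases M
      located : ComponentsLocated M H

  marking-bondClosed : ∀ {M} → IsMarking N M → ∀ x → BondClosed (M at x)
  marking-bondClosed isM x = proj₂ (proj₂ (isM x))

  marking-no-ntok : ∀ {M} → IsMarking N M → ∀ {z a} → ¬ M z (ntok a) ≡ true
  marking-no-ntok isM {z} {a} m with trans (sym m) (proj₁ (isM z) a)
  ... | ()

  marking-no-nbnd : ∀ {M} → IsMarking N M → ∀ {z β} → ¬ M z (nbnd β) ≡ true
  marking-no-nbnd isM {z} {β} m with trans (sym m) (proj₁ (proj₂ (isM z)) β)
  ... | ()

  unique-items : ∀ {M} → IsMarking N M → UniqueBases M → ∀ {x w} i → M x i ≡ true → M w i ≡ true → x ≡ w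
  unique-items isM unique (tok c) m₁ m₂ = unique c _ _ m₁ m₂
  unique-items {M} isM unique {x} {w} (bnd β) m₁ m₂ with ends β in e
  ... | (a , b) = unique a x w (proj₁ (marking-bondClosed {M} isM x β a b e m₁))
                               (proj₁ (marking-bondClosed {M} isM w β a b e m₂))
  unique-items {M} isM _ (ntok _) m₁ _ = ⊥-elim (marking-no-ntok {M} isM m₁)
  unique-items {M} isM _ (nbnd _) m₁ _ = ⊥-elim (marking-no-nbnd {M} isM m₁)

  consistent-initial : Consistent M₀ (λ _ → [])
  consistent-initial = record
    { marking = proj₁ initialOK
    ; unique = λ c y₁ y₂ m₁ m₂ →
        let (_ , _ , only) = proj₂ initialOK c in trans (only y₁ m₁) (sym (only y₂ m₂))
    ; located = λ z c _ →
        inj₂ ((λ { (_ , _ , (_ , ()) , _) }) , con-⊆ (marking-bondClosed {M₀} (proj₁ initialOK) z))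
    }

  tok-∉-eff : ∀ {t a} → ¬ eff N t (tok a)
  tok-∉-eff {t} {a} (p , ¬p) = ¬p (from (proj₁ (wellFormed t) a) p)

  post⇒pre : ∀ {t a} → post N t (tok a) → pre N t (tok a)
  post⇒pre {t} {a} = from (proj₁ (wellFormed t) a)

  pre⇒post : ∀ {t a} → pre N t (tok a) → post N t (tok a)
  pre⇒post {t} {a} = to (proj₁ (wellFormed t) a)

  module Reversal (t : Trans N) (M : Marking N) (H : History N) where
    Stripped : Place N → Pred
    Stripped z j = M z j ≡ true × ¬ eff N t j

    Component : Place N → Fin nA → Pred
    Component z a = con N a (Stripped z)

    Relocated : Place N → Pred
    Relocated x i = Σ (Place N) λ y → Σ (Fin nA) λ a →
      M y (tok a) ≡ true × post N t (tok a) × LastP N (Component y a) H x × Component y a i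

    Discarded : Place N → Pred
    Discarded x i = eff N t i ⊎ Σ (Fin nA) λ a →
      M x (tok a) ≡ true × post N t (tok a) × ¬ LastP N (Component x a) H x × Component x a i

    stripped? : ∀ y → DecidablePred (Stripped y)
    stripped? y j = (M y j Boolₚ.≟ true) ×-dec ¬? (eff? t j)

  module ForwardStep (M : Marking N) (H : History N) (t : Trans N) (M' : Marking N) (H' : History N)
                     (consistent : Consistent M H) (fstep : FStep N (M , H) t (M' , H')) where
    open Consistent consistent
    open Reversal t M' H

    enabled : FEnabled N (M , H) t
    enabled = proj₁ fstep

    pre-present : ∀ {w a} → Fpt w t (tok a) ≡ true → M w (tok a) ≡ true
    pre-present {w} {a} = proj₁ enabled w a

    pre-bond-present : ∀ x β → Fpt x t (bnd β) ≡ true → M x (bnd β) ≡ true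
    pre-bond-present = proj₁ (proj₂ (proj₂ enabled))

    separated : ∀ a b y₁ y₂ → Ftp t y₁ (tok a) ≡ true → Ftp t y₂ (tok b) ≡ true → y₁ ≢ y₂ →
                ∀ x → InPre N x t → ¬ con N a (M at x) (tok b)
    separated = proj₁ (proj₂ (proj₂ (proj₂ (proj₂ enabled))))

    bonds-from-pre : ∀ β x y → Ftp t x (bnd β) ≡ true → InPre N y t → M y (bnd β) ≡ true →
                     Fpt y t (bnd β) ≡ true
    bonds-from-pre = proj₂ (proj₂ (proj₂ (proj₂ (proj₂ enabled))))

    history-t : ∀ n → n ∈ H' t ⇔ (n ∈ H t ⊎ n ≡ suc (maxAll N H))
    history-t = proj₁ (proj₂ (proj₂ fstep))

    history-other : SameExcept t H H'
    history-other = proj₂ (proj₂ (proj₂ fstep))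

    Consumed : Place N → Pred
    Consumed x i = Σ (Fin nA) λ a → Fpt x t (tok a) ≡ true × con N a (M at x) i

    Produced : Place N → Pred
    Produced x i = Ftp t x i ≡ true ⊎ Σ (Fin nA) λ a → Σ (Place N) λ y →
      Ftp t x (tok a) ≡ true × Fpt y t (tok a) ≡ true × con N a (M at y) i

    after-cases : ∀ {x i} → M' x i ≡ true → (M x i ≡ true × ¬ Consumed x i) ⊎ Produced x i
    after-cases {x} {i} = to (proj₁ (proj₂ fstep) x i)

    after-kept : ∀ {x i} → M x i ≡ true → ¬ Consumed x i → M' x i ≡ true
    after-kept {x} {i} m ¬c = from (proj₁ (proj₂ fstep) x i) (inj₁ (m , ¬c))

    after-output : ∀ {x i} → Ftp t x i ≡ true → M' x i ≡ true
    after-output {x} {i} f = from (proj₁ (proj₂ fstep) x i) (inj₂ (inj₁ f))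

    after-carried : ∀ {x i a y} → Ftp t x (tok a) ≡ true → Fpt y t (tok a) ≡ true → con N a (M at y) i →
                    M' x i ≡ true
    after-carried {x} {i} {a} {y} f p k = from (proj₁ (proj₂ fstep) x i) (inj₂ (inj₂ (a , y , f , p , k)))

    bondClosed : ∀ x → BondClosed (M at x)
    bondClosed = marking-bondClosed {M} marking

    same-place : ∀ {x w} i → M x i ≡ true → M w i ≡ true → x ≡ w
    same-place = unique-items {M} marking unique

    pre-base-consumed : ∀ {z b} → M z (tok b) ≡ true → pre N t (tok b) → Consumed z (tok b)
    pre-base-consumed {z} {b} m (w , fpt) =
      b , subst (λ v → Fpt v t (tok b) ≡ true) (unique b w z (pre-present fpt) m) fpt , con-self m

    carried-base-consumed : ∀ {z a w b} → M z (tok b) ≡ true → Fpt w t (tok a) ≡ true →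
                            con N a (M at w) (tok b) → Consumed z (tok b)
    carried-base-consumed {z} {a} {w} {b} m fpt k with unique b w z (con-⊆ (bondClosed w) _ k) m
    ... | refl = a , fpt , k

    same-output : ∀ {a b y₁ y₂ x} → Ftp t y₁ (tok a) ≡ true → Ftp t y₂ (tok b) ≡ true → InPre N x t →
                  con N a (M at x) (tok b) → y₁ ≡ y₂
    same-output {a} {b} {y₁} {y₂} {x} f₁ f₂ inPre k with y₁ Finₚ.≟ y₂
    ... | yes e = e
    ... | no y₁≢y₂ = ⊥-elim (separated a b y₁ y₂ f₁ f₂ y₁≢y₂ x inPre k)

    -- Condition (4) of enabledness: t creates no bond that is already present.
    marked-∉-eff : ∀ {z} i → M z i ≡ true → ¬ eff N t i
    marked-∉-eff (tok _) _ = tok-∉-eff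
    marked-∉-eff {z} (bnd β) m with ends β in e
    ... | (a , b) = λ ((x , ftp) , ¬pre) →
      let (w , fpt) = post⇒pre (x , proj₁ (Ftp-bond t x β a b e ftp))
          z≡w = unique a z w (proj₁ (bondClosed z β a b e m)) (pre-present fpt)
      in ¬pre (w , bonds-from-pre β x w ftp (tok a , fpt) (subst (λ v → M v (bnd β) ≡ true) z≡w m))
    marked-∉-eff (ntok _) m = ⊥-elim (marking-no-ntok {M} marking m)
    marked-∉-eff (nbnd _) m = ⊥-elim (marking-no-nbnd {M} marking m)

    bond-follows-end : ∀ {v w β b c} → Connects N β b c → M v (bnd β) ≡ true → M w (tok b) ≡ true →
                       M w (bnd β) ≡ true
    bond-follows-end {v} {w} {β} {b} cn mβ mb =
      subst (λ u → M u (bnd β) ≡ true) (unique b v w (proj₁ (connects-ends {M at v} (bondClosed v) cn mβ)) mb) mβ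

    bond-restored : ∀ {y w β b c} → Connects N β b c → M' y (bnd β) ≡ true → ¬ eff N t (bnd β) →
                    M w (tok b) ≡ true → M w (bnd β) ≡ true
    bond-restored {y} {β = β} cn m' ¬eff mb with after-cases m'
    ... | inj₁ (mβ , _) = bond-follows-end cn mβ mb
    ... | inj₂ (inj₁ ftp) =
      let (w , fpt) = decidable-stable (pre? t (bnd β)) λ ¬pre → ¬eff ((y , ftp) , ¬pre)
      in bond-follows-end cn (pre-bond-present w β fpt) mb
    ... | inj₂ (inj₂ (_ , w , _ , _ , kβ)) = bond-follows-end cn (con-⊆ (bondClosed w) _ kβ) mb

    component-restored : ∀ {a w y} → Fpt w t (tok a) ≡ true → Ftp t y (tok a) ≡ true →
                         Component y a ≐ con N a (M at w)
    component-restored {a} {w} fpt ftp =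
      con-minimal (con N a (M at w)) (con-self (pre-present fpt))
        (λ _ _ _ cn (m'β , ¬eff) _ kb →
          let mβ = bond-restored cn m'β ¬eff (con-⊆ (bondClosed w) _ kb)
          in con-extend kb cn mβ (proj₂ (connects-ends {M at w} (bondClosed w) cn mβ))) ,
      con-mono (λ j kj → after-carried ftp fpt kj , marked-∉-eff j (con-⊆ (bondClosed w) j kj))

    marking' : IsMarking N M'
    marking' x = (λ a → Boolₚ.¬-not {y = true} λ m → no-ntok (after-cases m))
               , (λ β → Boolₚ.¬-not {y = true} λ m → no-nbnd (after-cases m))
               , closed
      where
      no-ntok : ∀ {a} → ¬ ((M x (ntok a) ≡ true × ¬ Consumed x (ntok a)) ⊎ Produced x (ntok a))
      no-ntok (inj₁ (m , _)) = marking-no-ntok {M} marking m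
      no-ntok {a} (inj₂ (inj₁ f)) with trans (sym f) (Ftp-ntok t x a)
      ... | ()
      no-ntok (inj₂ (inj₂ (_ , _ , _ , _ , k))) = con-no-ntok k
      no-nbnd : ∀ {β} → ¬ ((M x (nbnd β) ≡ true × ¬ Consumed x (nbnd β)) ⊎ Produced x (nbnd β))
      no-nbnd (inj₁ (m , _)) = marking-no-nbnd {M} marking m
      no-nbnd {β} (inj₂ (inj₁ f)) with trans (sym f) (Ftp-nbnd t x β)
      ... | ()
      no-nbnd (inj₂ (inj₂ (_ , _ , _ , _ , k))) = con-no-nbnd k
      closed : BondClosed (M' at x)
      closed β a b e m with after-cases m
      ... | inj₁ (mβ , ¬c) = let (ma , mb) = bondClosed x β a b e mβ in
        after-kept ma (λ (a' , fpt , ka) → ¬c (a' , fpt , proj₁ (con-extend ka (inj₁ e) mβ mb))) ,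
        after-kept mb (λ (a' , fpt , kb) → ¬c (a' , fpt , proj₁ (con-extend kb (inj₂ e) mβ ma)))
      ... | inj₂ (inj₁ ftp) = let (fa , fb) = Ftp-bond t x β a b e ftp in after-output fa , after-output fb
      ... | inj₂ (inj₂ (_ , _ , ftp , fpt , kβ)) =
        let (ka , kb) = con-bond-ends e kβ in after-carried ftp fpt ka , after-carried ftp fpt kb

    unique' : UniqueBases M'
    unique' c y₁ y₂ m₁ m₂ = cases (after-cases m₁) (after-cases m₂)
      where
      cases : (M y₁ (tok c) ≡ true × ¬ Consumed y₁ (tok c)) ⊎ Produced y₁ (tok c) →
              (M y₂ (tok c) ≡ true × ¬ Consumed y₂ (tok c)) ⊎ Produced y₂ (tok c) → y₁ ≡ y₂
      cases (inj₁ (m₁ , _)) (inj₁ (m₂ , _)) = unique c y₁ y₂ m₁ m₂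
      cases (inj₁ (m , ¬c)) (inj₂ (inj₁ f)) = ⊥-elim (¬c (pre-base-consumed m (post⇒pre (_ , f))))
      cases (inj₁ (m , ¬c)) (inj₂ (inj₂ (_ , _ , _ , fpt , k))) = ⊥-elim (¬c (carried-base-consumed m fpt k))
      cases (inj₂ (inj₁ f)) (inj₁ (m , ¬c)) = ⊥-elim (¬c (pre-base-consumed m (post⇒pre (_ , f))))
      cases (inj₂ (inj₂ (_ , _ , _ , fpt , k))) (inj₁ (m , ¬c)) = ⊥-elim (¬c (carried-base-consumed m fpt k))
      cases (inj₂ (inj₁ f₁)) (inj₂ (inj₁ f₂)) =
        let (_ , fpt) = post⇒pre (_ , f₁) in same-output f₁ f₂ (tok c , fpt) (con-self (pre-present fpt))
      cases (inj₂ (inj₁ f₁)) (inj₂ (inj₂ (a , _ , f₂ , fpt , k))) = sym (same-output f₂ f₁ (tok a , fpt) k)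
      cases (inj₂ (inj₂ (a , _ , f₁ , fpt , k))) (inj₂ (inj₁ f₂)) = same-output f₁ f₂ (tok a , fpt) k
      cases (inj₂ (inj₂ (a₁ , w₁ , f₁ , fpt₁ , k₁))) (inj₂ (inj₂ (_ , w₂ , f₂ , fpt₂ , k₂)))
        with unique c w₁ w₂ (con-⊆ (bondClosed w₁) _ k₁) (con-⊆ (bondClosed w₂) _ k₂)
      ... | refl = same-output f₁ f₂ (tok a₁ , fpt₁) (con-meet (tok c) (pre-present fpt₂) k₁ k₂)

    fresh-∈ : suc (maxAll N H) ∈ H' t
    fresh-∈ = from (history-t _) (inj₂ refl)

    maxList-fired : maxList N (H' t) ≡ suc (maxAll N H)
    maxList-fired = ℕₚ.≤-antisym upper (maxList-upper fresh-∈)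
      where
      upper : maxList N (H' t) ≤ suc (maxAll N H)
      upper with to (history-t _) (maxList-∈ fresh-∈)
      ... | inj₁ old = ℕₚ.m≤n⇒m≤1+n (maxAll-upper H t old)
      ... | inj₂ e = ℕₚ.≤-reflexive e

    fired-last : ∀ t' → t' ≢ t → Nonempty N (H' t') → maxList N (H' t') < maxList N (H' t)
    fired-last t' t'≢t (n , n∈) =
      subst₂ _<_ (sym (maxList-cong (history-other t' t'≢t))) (sym maxList-fired)
        (s≤s (maxAll-upper H t' (maxList-∈ (to (history-other t' t'≢t n) n∈))))

    kept-located : ∀ {z c} → M z (tok c) ≡ true → ¬ Consumed z (tok c) → LastP N (con N c (M' at z)) H' z
    kept-located {z} {c} m ¬consumed = lastP-resp-≐ D≐ (lastP-unaffected disjoint history-other (located z c m))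
      where
      D : Pred
      D = con N c (M at z)
      untouched : ∀ j → D j → M z j ≡ true × ¬ Consumed z j
      untouched j dj = con-⊆ (bondClosed z) j dj , λ (a , fpt , kj) → ¬consumed (a , fpt , con-meet j m kj dj)
      disjoint : DisjointFromPost t D
      disjoint (tok p) pp dp = let (mp , ¬c) = untouched _ dp in ¬c (pre-base-consumed mp (post⇒pre pp))
      disjoint (bnd β) (y , ftp) dp with ends β in e
      ... | (a , b) = disjoint (tok a) (y , proj₁ (Ftp-bond t y β a b e ftp)) (proj₁ (con-bond-ends e dp))
      disjoint (ntok _) _ dp = con-no-ntok dp
      disjoint (nbnd _) _ dp = con-no-nbnd dp
      closed : ∀ {β b c'} → Connects N β b c' → M' z (bnd β) ≡ true → D (tok b) → D (bnd β) × D (tok c')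
      closed cn m'β db with after-cases m'β
      ... | inj₁ (mβ , _) = con-extend db cn mβ (proj₂ (connects-ends {M at z} (bondClosed z) cn mβ))
      ... | inj₂ (inj₁ ftp) = ⊥-elim (disjoint _ (z , Ftp-connects cn ftp) db)
      ... | inj₂ (inj₂ (_ , _ , _ , fpt , kβ)) =
        let (mb , ¬c) = untouched _ db in ⊥-elim (¬c (carried-base-consumed mb fpt (con-connects-left cn kβ)))
      D≐ : D ≐ con N c (M' at z)
      D≐ = con-mono (λ j dj → let (mj , ¬cj) = untouched j dj in after-kept mj ¬cj) ,
           con-minimal D (con-self m) λ _ _ _ cn m'β _ db → closed cn m'β db

    produced-output-base : ∀ {z c} → M' z (tok c) ≡ true → Produced z (tok c) →
                           Σ (Fin nA) λ a → Ftp t z (tok a) ≡ true × con N c (M' at z) (tok a)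
    produced-output-base {c = c} m' (inj₁ ftp) = c , ftp , con-self m'
    produced-output-base m' (inj₂ (a , _ , ftp , fpt , kc)) =
      a , ftp , con-sym (con-mono (λ _ kj → after-carried ftp fpt kj) _ kc) (after-output ftp)

    -- the component now contains an output of t, whose firing is the latest one
    produced-located : ∀ {z c} → M' z (tok c) ≡ true → Produced z (tok c) → LastP N (con N c (M' at z)) H' z
    produced-located {z} m' produced with produced-output-base m' produced
    ... | (a , ftp , ka) = inj₁ (t , last , λ y → mk⇔
          (λ (i , f , ki) → unique-items {M'} marking' unique' i (after-output f)
                               (con-⊆ (marking-bondClosed {M'} marking' z) i ki))
          (λ { refl → tok a , ftp , ka }))
      where
      last : LastT N (con N _ (M' at z)) H' t
      last = (tok a , (z , ftp) , ka) , (_ , fresh-∈) , λ t' t'≢t _ ne → fired-last t' t'≢t ne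

    consistent' : Consistent M' H'
    consistent' = record { marking = marking' ; unique = unique' ; located = located' }
      where
      located' : ComponentsLocated M' H'
      located' z c m' with after-cases m'
      ... | inj₁ (m , ¬c) = kept-located m ¬c
      ... | inj₂ produced = produced-located m' produced

    reversed-history : ∀ n → n ∈ H t ⇔ (n ∈ H' t × n ≢ maxList N (H' t))
    reversed-history n = mk⇔
      (λ n∈ → from (history-t n) (inj₁ n∈) ,
              λ e → ℕₚ.<-irrefl refl (subst (_≤ maxAll N H) (trans e maxList-fired) (maxAll-upper H t n∈)))
      (λ (n∈' , n≢) → old (to (history-t n) n∈') n≢)
      where
      old : n ∈ H t ⊎ n ≡ suc (maxAll N H) → n ≢ maxList N (H' t) → n ∈ H t
      old (inj₁ n∈) _ = n∈
      old (inj₂ e) n≢ = ⊥-elim (n≢ (trans e (sym maxList-fired)))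

    output-place : ∀ {y a} → M' y (tok a) ≡ true → post N t (tok a) → Ftp t y (tok a) ≡ true
    output-place {a = a} m (y₀ , f) = subst (λ v → Ftp t v (tok a) ≡ true) (unique' a y₀ _ (after-output f) m) f

    restored-lastP : ∀ {a w y} → Fpt w t (tok a) ≡ true → Ftp t y (tok a) ≡ true → LastP N (Component y a) H w
    restored-lastP fpt ftp = lastP-resp-≐ (≐-sym (component-restored fpt ftp)) (located _ _ (pre-present fpt))

    relocated⇒marked : ∀ {x y a w i} → Fpt w t (tok a) ≡ true → Ftp t y (tok a) ≡ true →
                       LastP N (Component y a) H x → Component y a i → M x i ≡ true
    relocated⇒marked {i = i} fpt ftp last ki
      with lastP-functional last (restored-lastP fpt ftp) (_ , con-self (after-output ftp , tok-∉-eff))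
    ... | refl = con-⊆ (bondClosed _) i (proj₁ (component-restored fpt ftp) i ki)

    undiscarded-lastP : ∀ {x a i} → Ftp t x (tok a) ≡ true → ¬ Discarded x i → Component x a i →
                        LastP N (Component x a) H x
    undiscarded-lastP {x} {a} ftp ¬d ki =
      lastP-stable (con? (stripped? x) a) λ ¬last → ¬d (inj₂ (a , after-output ftp , (x , ftp) , ¬last , ki))

    output-restored : ∀ {x} i → Ftp t x i ≡ true → ¬ Discarded x i → M x i ≡ true
    output-restored (tok a) ftp ¬d =
      let (_ , fpt) = post⇒pre (_ , ftp)
          ka = con-self (after-output ftp , tok-∉-eff)
      in relocated⇒marked fpt ftp (undiscarded-lastP ftp ¬d ka) ka
    output-restored {x} (bnd β) ftp ¬d with ends β in e
    ... | (b , c) =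
      let (fb , fc) = Ftp-bond t x β b c e ftp
          (_ , fpt) = post⇒pre (x , fb)
          kβ = proj₁ (con-extend (con-self (after-output fb , tok-∉-eff)) (inj₁ e)
                                 (after-output ftp , λ ef → ¬d (inj₁ ef)) (after-output fc , tok-∉-eff))
      in relocated⇒marked fpt fb (undiscarded-lastP fb ¬d kβ) kβ
    output-restored {x} (ntok a) ftp _ with trans (sym ftp) (Ftp-ntok t x a)
    ... | ()
    output-restored {x} (nbnd β) ftp _ with trans (sym ftp) (Ftp-nbnd t x β)
    ... | ()

    reversed⇒marked : ∀ {x i} → (M' x i ≡ true ⊎ Relocated x i) × ¬ Discarded x i → M x i ≡ true
    reversed⇒marked (inj₂ (_ , _ , m' , pa , last , ki) , _) =
      let (_ , fpt) = post⇒pre pa in relocated⇒marked fpt (output-place m' pa) last ki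
    reversed⇒marked {i = i} (inj₁ m' , ¬d) with after-cases m'
    ... | inj₁ (m , _) = m
    ... | inj₂ (inj₁ ftp) = output-restored i ftp ¬d
    ... | inj₂ (inj₂ (_ , _ , ftp , fpt , k)) =
      let ki = proj₂ (component-restored fpt ftp) i k in relocated⇒marked fpt ftp (undiscarded-lastP ftp ¬d ki) ki

    consumed? : ∀ x i → Dec (Consumed x i)
    consumed? x i = Finₚ.any? λ a → (Fpt x t (tok a) Boolₚ.≟ true) ×-dec con? (λ j → M x j Boolₚ.≟ true) a i

    marked⇒kept-or-relocated : ∀ {x i} → M x i ≡ true → M' x i ≡ true ⊎ Relocated x i
    marked⇒kept-or-relocated {x} {i} m with consumed? x i
    ... | no ¬c = inj₁ (after-kept m ¬c)
    ... | yes (a , fpt , ki) = let (y , ftp) = pre⇒post (x , fpt) in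
      inj₂ (y , a , after-output ftp , (y , ftp) , restored-lastP fpt ftp , proj₂ (component-restored fpt ftp) i ki)

    marked⇒undiscarded : ∀ {x i} → M x i ≡ true → ¬ Discarded x i
    marked⇒undiscarded {i = i} m (inj₁ ef) = marked-∉-eff i m ef
    marked⇒undiscarded {x} {i} m (inj₂ (a , m' , pa , ¬last , ki)) =
      let ftp = output-place m' pa
          (w , fpt) = post⇒pre pa
          x≡w = same-place i m (con-⊆ (bondClosed w) i (proj₁ (component-restored fpt ftp) i ki))
      in ¬last (subst (LastP N (Component x a) H) (sym x≡w) (restored-lastP fpt ftp))

    reversible : OStep N (M' , H') t (M , H)
    reversible = (_ , fresh-∈) , reversed-history , sameExcept-sym history-other ,
      λ x i → mk⇔ (λ m → marked⇒kept-or-relocated m , marked⇒undiscarded m) reversed⇒marked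

  module ReverseStep (M : Marking N) (H : History N) (t : Trans N) (M' : Marking N) (H' : History N)
                     (consistent : Consistent M H) (ostep : OStep N (M , H) t (M' , H')) where
    open Consistent consistent
    open Reversal t M H'

    history-other : SameExcept t H H'
    history-other = proj₁ (proj₂ (proj₂ ostep))

    after-cases : ∀ {x i} → M' x i ≡ true → (M x i ≡ true ⊎ Relocated x i) × ¬ Discarded x i
    after-cases {x} {i} = to (proj₂ (proj₂ (proj₂ ostep)) x i)

    after-intro : ∀ {x i} → M x i ≡ true ⊎ Relocated x i → ¬ Discarded x i → M' x i ≡ true
    after-intro {x} {i} kept ¬d = from (proj₂ (proj₂ (proj₂ ostep)) x i) (kept , ¬d)

    bondClosed : ∀ x → BondClosed (M at x)
    bondClosed = marking-bondClosed {M} marking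

    same-place : ∀ {x w} i → M x i ≡ true → M w i ≡ true → x ≡ w
    same-place = unique-items {M} marking unique

    stripped-bondClosed : ∀ z → BondClosed (Stripped z)
    stripped-bondClosed z β a b e (m , _) =
      let (ma , mb) = bondClosed z β a b e m in (ma , tok-∉-eff) , (mb , tok-∉-eff)

    component-⊆ : ∀ {z a j} → Component z a j → M z j ≡ true
    component-⊆ {z} {j = j} k = proj₁ (con-⊆ (stripped-bondClosed z) j k)

    component-∌-eff : ∀ {z a j} → Component z a j → ¬ eff N t j
    component-∌-eff {z} {j = j} k = proj₂ (con-⊆ (stripped-bondClosed z) j k)

    component-⊆-con : ∀ {z a} → Component z a ⊆ con N a (M at z)
    component-⊆-con = con-mono (λ _ k → component-⊆ k)

    component-place : ∀ {y y' a a' j} → Component y a j → Component y' a' j → y ≡ y'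
    component-place {j = j} k k' = same-place j (component-⊆ k) (component-⊆ k')

    component-same : ∀ {y a a' j} → Component y a j → Component y a' j → Component y a ≐ Component y a'
    component-same {y} {j = j} k k' =
      con-meet-same j (con-source (stripped-bondClosed y) k) (con-source (stripped-bondClosed y) k') k k'

    undiscarded-lastP : ∀ {x a i} → M x (tok a) ≡ true → post N t (tok a) → ¬ Discarded x i →
                        Component x a i →
                        LastP N (Component x a) H' x
    undiscarded-lastP {x} {a} ma pa ¬d ki =
      lastP-stable (con? (stripped? x) a) λ ¬last → ¬d (inj₂ (a , ma , pa , ¬last , ki))

    relocated-after : ∀ {x y a j} → M y (tok a) ≡ true → post N t (tok a) → LastP N (Component y a) H' x →
                      Component y a j → M' x j ≡ true
    relocated-after {x} {y} {a} {j} ma pa last kj = after-intro (inj₂ (y , a , ma , pa , last , kj)) λ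
      { (inj₁ ef) → component-∌-eff kj ef
      ; (inj₂ (_ , _ , _ , ¬last , k)) → ¬last (moved k) }
      where
      moved : ∀ {a'} → Component x a' j → LastP N (Component x a') H' x
      moved k with component-place k kj
      ... | refl = lastP-resp-≐ (component-same kj k) last

    marking' : IsMarking N M'
    marking' x = (λ a → Boolₚ.¬-not {y = true} λ m → no-ntok (proj₁ (after-cases m)))
               , (λ β → Boolₚ.¬-not {y = true} λ m → no-nbnd (proj₁ (after-cases m)))
               , closed
      where
      no-ntok : ∀ {a} → ¬ (M x (ntok a) ≡ true ⊎ Relocated x (ntok a))
      no-ntok (inj₁ m) = marking-no-ntok {M} marking m
      no-ntok (inj₂ (_ , _ , _ , _ , _ , k)) = con-no-ntok k
      no-nbnd : ∀ {β} → ¬ (M x (nbnd β) ≡ true ⊎ Relocated x (nbnd β))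
      no-nbnd (inj₁ m) = marking-no-nbnd {M} marking m
      no-nbnd (inj₂ (_ , _ , _ , _ , _ , k)) = con-no-nbnd k
      kept-end : ∀ {β d e} → Connects N β d e → M x (bnd β) ≡ true → ¬ Discarded x (bnd β) →
                 M' x (tok d) ≡ true
      kept-end cn mβ ¬d =
        let (md , me) = connects-ends {M at x} (bondClosed x) cn mβ in
        after-intro (inj₁ md) λ
          { (inj₁ ef) → tok-∉-eff ef
          ; (inj₂ (a , ma , pa , ¬last , k)) → ¬d (inj₂ (a , ma , pa , ¬last ,
              proj₁ (con-extend k cn (mβ , λ ef → ¬d (inj₁ ef)) (me , tok-∉-eff)))) }
      closed : BondClosed (M' at x)
      closed β a b e m with after-cases m
      ... | (inj₁ mβ , ¬d) = kept-end (inj₁ e) mβ ¬d , kept-end (inj₂ e) mβ ¬d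
      ... | (inj₂ (_ , _ , ma , pa , last , kβ) , _) =
        let (ka , kb) = con-bond-ends e kβ in relocated-after ma pa last ka , relocated-after ma pa last kb

    unique' : UniqueBases M'
    unique' c x₁ x₂ m₁ m₂ = cases (after-cases m₁) (after-cases m₂)
      where
      kept-vs-relocated : ∀ {x₁ x₂} → M x₁ (tok c) ≡ true → ¬ Discarded x₁ (tok c) →
                          Relocated x₂ (tok c) → x₁ ≡ x₂
      kept-vs-relocated mc ¬d (_ , _ , ma , pa , last , k) with same-place (tok c) (component-⊆ k) mc
      ... | refl = lastP-functional (undiscarded-lastP ma pa ¬d k) last (c , k)
      cases : (M x₁ (tok c) ≡ true ⊎ Relocated x₁ (tok c)) × ¬ Discarded x₁ (tok c) →
              (M x₂ (tok c) ≡ true ⊎ Relocated x₂ (tok c)) × ¬ Discarded x₂ (tok c) → x₁ ≡ x₂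
      cases (inj₁ m₁ , _) (inj₁ m₂ , _) = unique c x₁ x₂ m₁ m₂
      cases (inj₁ m₁ , ¬d) (inj₂ r , _) = kept-vs-relocated m₁ ¬d r
      cases (inj₂ r , _) (inj₁ m₂ , ¬d) = sym (kept-vs-relocated m₂ ¬d r)
      cases (inj₂ (_ , _ , _ , _ , last₁ , k₁) , _) (inj₂ (_ , _ , _ , _ , last₂ , k₂) , _)
        with component-place k₁ k₂
      ... | refl = lastP-functional last₁ (lastP-resp-≐ (component-same k₂ k₁) last₂) (c , k₁)

    -- Used also with y = x, for a component that reversal leaves in place.
    relocated-located : ∀ {x y a c} → M y (tok a) ≡ true → post N t (tok a) → LastP N (Component y a) H' x →
                        Component y a (tok c) → LastP N (con N c (M' at x)) H' x
    relocated-located {x} {y} {a} {c} ma pa last kc = lastP-resp-≐ same last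
      where
      a∈ : Stripped y (tok a)
      a∈ = con-source (stripped-bondClosed y) kc
      closed : ∀ {β b c'} → Connects N β b c' → M' x (bnd β) ≡ true → Component y a (tok b) →
               Component y a (bnd β) × Component y a (tok c')
      closed {β} cn m'β kb with after-cases m'β
      ... | (inj₁ mβ , ¬d)
        with same-place (tok _) (proj₁ (connects-ends {M at x} (bondClosed x) cn mβ)) (component-⊆ kb)
      ... | refl = con-extend kb cn (mβ , λ ef → ¬d (inj₁ ef))
                     (proj₂ (connects-ends {M at x} (bondClosed x) cn mβ) , tok-∉-eff)
      closed cn m'β kb | (inj₂ (_ , _ , _ , _ , _ , kβ) , _) with component-place (con-connects-left cn kβ) kb
      ... | refl = let e = component-same (con-connects-left cn kβ) kb in
                   proj₁ e _ kβ , proj₁ e _ (con-connects-right cn kβ)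
      same : Component y a ≐ con N c (M' at x)
      same = (λ j kj → con-mono (λ j' kj' → relocated-after ma pa last (proj₁ (con-same kc a∈) j' kj'))
                                j (proj₂ (con-same kc a∈) j kj)) ,
             con-minimal (Component y a) kc (λ _ _ _ cn m'β _ kb → closed cn m'β kb)

    Mobile : Place N → Fin nA → Set
    Mobile z c = Σ (Fin nA) λ a → M z (tok a) ≡ true × post N t (tok a) × Component z a (tok c)

    mobile? : ∀ z c → Dec (Mobile z c)
    mobile? z c = Finₚ.any? λ a →
      (M z (tok a) Boolₚ.≟ true) ×-dec (post? t (tok a) ×-dec con? (stripped? z) a (tok c))

    path-stripped-or-mobile : ∀ {z c d} → M z (tok c) ≡ true → Path N (M at z) c d →
                              Path N (Stripped z) c d ⊎ Mobile z c
    path-stripped-or-mobile mz here = inj₁ here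
    path-stripped-or-mobile mz (step β p cn mβ md) with path-stripped-or-mobile mz p
    ... | inj₂ mobile = inj₂ mobile
    ... | inj₁ p' with eff? t (bnd β)
    ... | no ¬eff = inj₁ (step β p' cn (mβ , ¬eff) (md , tok-∉-eff))
    ... | yes ((y , ftp) , _) =
      inj₂ (_ , path-target p mz , (y , Ftp-connects cn ftp) ,
            path⇒con (path-reverse p' (mz , tok-∉-eff)) (mz , tok-∉-eff))

    immobile-disjoint : ∀ {z c} → M z (tok c) ≡ true → ¬ Mobile z c → DisjointFromPost t (con N c (M at z))
    immobile-disjoint {z} {c} mz ¬mobile = disjoint
      where
      disjoint : DisjointFromPost t (con N c (M at z))
      disjoint (tok p) pp dp with path-stripped-or-mobile mz (con⇒path dp)
      ... | inj₂ mobile = ¬mobile mobile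
      ... | inj₁ p' = ¬mobile (_ , con-⊆ (bondClosed z) _ dp , pp ,
                               path⇒con (path-reverse p' (mz , tok-∉-eff)) (mz , tok-∉-eff))
      disjoint (bnd β) (y , ftp) dp with ends β in e
      ... | (a , b) = disjoint (tok a) (y , proj₁ (Ftp-bond t y β a b e ftp)) (proj₁ (con-bond-ends e dp))
      disjoint (ntok _) _ dp = con-no-ntok dp
      disjoint (nbnd _) _ dp = con-no-nbnd dp

    immobile-located : ∀ {z c} → M z (tok c) ≡ true → ¬ Mobile z c → LastP N (con N c (M' at z)) H' z
    immobile-located {z} {c} mz ¬mobile =
      lastP-resp-≐ (con-mono kept , con-minimal D (con-self mz) λ _ _ _ cn m'β _ db → closed cn m'β db)
        (lastP-unaffected disjoint history-other (located z c mz))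
      where
      D : Pred
      D = con N c (M at z)
      disjoint : DisjointFromPost t D
      disjoint = immobile-disjoint mz ¬mobile
      kept : ∀ j → D j → M' z j ≡ true
      kept j dj = after-intro (inj₁ (con-⊆ (bondClosed z) j dj)) λ
        { (inj₁ ef) → disjoint j (proj₁ ef) dj
        ; (inj₂ (a , ma , pa , _ , k)) → disjoint (tok a) pa (con-sym (con-meet j mz (component-⊆-con j k) dj) ma) }
      closed : ∀ {β b c'} → Connects N β b c' → M' z (bnd β) ≡ true → D (tok b) → D (bnd β) × D (tok c')
      closed cn m'β db with after-cases m'β
      ... | (inj₁ mβ , _) = con-extend db cn mβ (proj₂ (connects-ends {M at z} (bondClosed z) cn mβ))
      ... | (inj₂ (_ , a , ma , pa , _ , kβ) , _)
        with same-place (tok _) (component-⊆ (con-connects-left cn kβ)) (con-⊆ (bondClosed z) _ db)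
      ... | refl = ⊥-elim (disjoint (tok a) pa (con-meet (tok _) ma db (component-⊆-con _ (con-connects-left cn kβ))))

    consistent' : Consistent M' H'
    consistent' = record { marking = marking' ; unique = unique' ; located = located' }
      where
      located' : ComponentsLocated M' H'
      located' z c m' with after-cases m'
      ... | (inj₂ (_ , _ , ma , pa , last , kc) , _) = relocated-located ma pa last kc
      ... | (inj₁ mz , ¬d) with mobile? z c
      ... | yes (_ , ma , pa , kc) = relocated-located ma pa (undiscarded-lastP ma pa ¬d kc) kc
      ... | no ¬mobile = immobile-located mz ¬mobile

  reachable-consistent : ∀ {M H} → Reachable N (M , H) → Consistent M H
  reachable-consistent init = consistent-initial
  reachable-consistent (fwd {M , H} {M' , H'} t r s) = ForwardStep.consistent' M H t M' H' (reachable-consistent r) s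
  reachable-consistent (rev {M , H} {M' , H'} t r s) = ReverseStep.consistent' M H t M' H' (reachable-consistent r) s

lemma5 : (N : RPN) → InitialOK N → WellFormed N →
    ∀ (M : Marking N) (H : History N) (t : Trans N) (M' : Marking N) (H' : History N) →
    Reachable N (M , H) → FStep N (M , H) t (M' , H') → OStep N (M' , H') t (M , H)
lemma5 N initialOK wellFormed M H t M' H' reachable fstep =
  ForwardStep.reversible M H t M' H' (reachable-consistent reachable) fstep
  where open Consistency N initialOK wellFormed
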